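{- Let $G$ be a monochromatic connected graph and let $H$ be a spanning connected subgraph of $G$ (with the edges of $H$ carrying the same single color). Then $pc_{opt}(G)\le pc_{opt}(H)$.
   Context: All graphs are finite and simple. An edge-colored graph is properly colored if no two adjacent edges share a color; an edge-colored connected graph is properly connected if between every pair of distinct vertices there is a properly colored path. A monochromatic graph is one in which every edge has the same color, called color $0$; any color $i\neq 0$ is a new color. For a monochromatic connected graph $G$, $pc_{opt}(G)$ is the minimum of $p+q$ over all ways to make $G$ properly connected by recoloring $p$ edges of $G$ using $q$ new colors. -}

module Defs where

open import Data.Nat using (ℕ; zero; suc; _+_; _<_; _≤_; _≟_; _<?_)
open import Data.Fin using (Fin; toℕ)
open import Data.Bool using (Bool; true; false; T)
open import Data.List using (List; []; _∷_; length; filter; map; allFin; cartesianProduct; deduplicate)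
open import Data.List.Relation.Unary.Unique.Propositional using (Unique)
open import Data.List.Relation.Unary.Linked using (Linked)
open import Data.Product using (Σ; _×_; _,_; proj₁; proj₂; ∃)
open import Relation.Binary.PropositionalEquality using (_≡_; _≢_)
open import Relation.Nullary using (¬_; ¬?)
open import Relation.Nullary.Decidable using (_×-dec_)
open import Data.Bool using (T?)

record Graph (n : ℕ) : Set where
  field
    adj   : Fin n → Fin n → Bool
    sym   : ∀ u v → adj u v ≡ adj v u
    irrefl : ∀ v → adj v v ≡ false
open Graph public

data Walk {n : ℕ} (G : Graph n) : Fin n → Fin n → Set where
  stop : ∀ {u} → Walk G u u
  step : ∀ {u w v} → adj G u w ≡ true → Walk G w v → Walk G u v

vertices : ∀ {n} {G : Graph n} {u v} → Walk G u v → List (Fin n)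
vertices {u = u} stop = u ∷ []
vertices {u = u} (step _ p) = u ∷ vertices p

IsPath : ∀ {n} {G : Graph n} {u v} → Walk G u v → Set
IsPath p = Unique (vertices p)

-- An edge coloring: a color (natural number) for each pair of vertices,
-- symmetric; only its values on edges matter.  Color 0 is the original color.
record EdgeColoring {n : ℕ} (G : Graph n) : Set where
  field
    col    : Fin n → Fin n → ℕ
    colSym : ∀ u v → col u v ≡ col v u
open EdgeColoring public

edgeColors : ∀ {n} {G : Graph n} → (Fin n → Fin n → ℕ) → ∀ {u v} → Walk G u v → List ℕ
edgeColors c stop = []
edgeColors c (step {u} {w} _ p) = c u w ∷ edgeColors c p

ProperlyColored : ∀ {n} {G : Graph n} → (Fin n → Fin n → ℕ) → ∀ {u v} → Walk G u v → Set
ProperlyColored c p = Linked _≢_ (edgeColors c p)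

Connected : ∀ {n} → Graph n → Set
Connected G = ∀ u v → Σ (Walk G u v) IsPath

ProperlyConnected : ∀ {n} (G : Graph n) → EdgeColoring G → Set
ProperlyConnected G c =
  ∀ u v → u ≢ v → Σ (Walk G u v) (λ p → IsPath p × ProperlyColored (col c) p)

SpanningSubgraph : ∀ {n} → Graph n → Graph n → Set
SpanningSubgraph H G = ∀ u v → adj H u v ≡ true → adj G u v ≡ true

edges : ∀ {n} → Graph n → List (Fin n × Fin n)
edges {n} G = filter (λ e → (toℕ (proj₁ e) <? toℕ (proj₂ e)) ×-dec T? (adj G (proj₁ e) (proj₂ e)))
                     (cartesianProduct (allFin n) (allFin n))

recoloredEdges : ∀ {n} (G : Graph n) → EdgeColoring G → List (Fin n × Fin n)
recoloredEdges G c = filter (λ e → ¬? (col c (proj₁ e) (proj₂ e) ≟ 0)) (edges G)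

numRecolored : ∀ {n} (G : Graph n) → EdgeColoring G → ℕ
numRecolored G c = length (recoloredEdges G c)

numNewColors : ∀ {n} (G : Graph n) → EdgeColoring G → ℕ
numNewColors G c =
  length (deduplicate _≟_ (map (λ e → col c (proj₁ e) (proj₂ e)) (recoloredEdges G c)))

Attainable : ∀ {n} → Graph n → ℕ → Set
Attainable G k = Σ (EdgeColoring G) λ c →
  ProperlyConnected G c × numRecolored G c + numNewColors G c ≡ k

IsPcOpt : ∀ {n} → Graph n → ℕ → Set
IsPcOpt G k = Attainable G k × (∀ k' → Attainable G k' → k ≤ k')

module Submission where

-- Let H be a spanning subgraph of G and c an edge coloring making H
-- properly connected at cost k.  Extend c to G by giving every edge of G outside
-- H the original color 0.  Then
--   * every properly colored path of H is, edge for edge, a properly colored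
--     path of G with the same colors, so G becomes properly connected;
--   * an edge of G gets a nonzero color exactly when it is an edge of H with
--     a nonzero color under c, so the recolored edges, and hence the new
--     colors, are literally the same lists for G and for H.
-- Thus every value attainable for H is attainable for G, and minimality of
-- pc_opt(G) gives pc_opt(G) ≤ pc_opt(H).

open import Defs
open import Level using (Level)
open import Data.Nat using (ℕ; _≤_; _<_; _+_; _≟_; _<?_)
open import Data.Empty using (⊥-elim)
open import Data.Fin using (Fin; toℕ)
open import Data.Bool using (true; false; if_then_else_; T; T?)
open import Data.Bool.Properties using (T-≡)
open import Data.List using (List; []; _∷_; length; filter; map; deduplicate; allFin; cartesianProduct)
open import Data.List.Properties using (filter-accept; filter-reject; filter-≐; map-cong-local)
open import Data.List.Relation.Unary.All.Properties using (all-filter)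
import Data.List.Relation.Unary.All as All
open import Data.List.Relation.Unary.Unique.Propositional using (Unique)
open import Data.List.Relation.Unary.Linked using (Linked)
open import Data.Product using (_×_; _,_; proj₁; proj₂)
open import Function.Bundles using (Equivalence)
open import Relation.Binary.PropositionalEquality
  using (_≡_; _≢_; refl; trans; cong; cong₂; subst; module ≡-Reasoning)
  renaming (sym to ≡-sym)
open import Relation.Nullary using (Dec; yes; no; ¬?)
open import Relation.Nullary.Decidable using (_×-dec_)
open import Relation.Unary using (Pred; Decidable; _∩_; _⊆_; _≐_)
open import Relation.Unary.Properties using (_∩?_)

filter-filter : ∀ {a p q : Level} {A : Set a} {P : Pred A p} {Q : Pred A q}
  (P? : Decidable P) (Q? : Decidable Q) (xs : List A) →
  filter Q? (filter P? xs) ≡ filter (P? ∩? Q?) xs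
filter-filter P? Q? [] = refl
filter-filter {P = P} {Q} P? Q? (x ∷ xs) = byCases (P? x) (Q? x)
  where
  open ≡-Reasoning
  IH : filter Q? (filter P? xs) ≡ filter (P? ∩? Q?) xs
  IH = filter-filter P? Q? xs
  byCases : Dec (P x) → Dec (Q x) →
    filter Q? (filter P? (x ∷ xs)) ≡ filter (P? ∩? Q?) (x ∷ xs)
  byCases (yes px) (yes qx) = begin
    filter Q? (filter P? (x ∷ xs))  ≡⟨ cong (filter Q?) (filter-accept P? px) ⟩
    filter Q? (x ∷ filter P? xs)    ≡⟨ filter-accept Q? qx ⟩
    x ∷ filter Q? (filter P? xs)    ≡⟨ cong (x ∷_) IH ⟩
    x ∷ filter (P? ∩? Q?) xs        ≡⟨ ≡-sym (filter-accept (P? ∩? Q?) (px , qx)) ⟩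
    filter (P? ∩? Q?) (x ∷ xs)      ∎
  byCases (yes px) (no ¬qx) = begin
    filter Q? (filter P? (x ∷ xs))  ≡⟨ cong (filter Q?) (filter-accept P? px) ⟩
    filter Q? (x ∷ filter P? xs)    ≡⟨ filter-reject Q? ¬qx ⟩
    filter Q? (filter P? xs)        ≡⟨ IH ⟩
    filter (P? ∩? Q?) xs            ≡⟨ ≡-sym (filter-reject (P? ∩? Q?) (λ pq → ¬qx (proj₂ pq))) ⟩
    filter (P? ∩? Q?) (x ∷ xs)      ∎
  byCases (no ¬px) _ = begin
    filter Q? (filter P? (x ∷ xs))  ≡⟨ cong (filter Q?) (filter-reject P? ¬px) ⟩
    filter Q? (filter P? xs)        ≡⟨ IH ⟩
    filter (P? ∩? Q?) xs            ≡⟨ ≡-sym (filter-reject (P? ∩? Q?) (λ pq → ¬px (proj₁ pq))) ⟩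
    filter (P? ∩? Q?) (x ∷ xs)      ∎

IsListedEdge : ∀ {n} → Graph n → Pred (Fin n × Fin n) Level.zero
IsListedEdge K (u , v) = toℕ u < toℕ v × T (adj K u v)

isListedEdge? : ∀ {n} (K : Graph n) → Decidable (IsListedEdge K)
isListedEdge? K (u , v) = (toℕ u <? toℕ v) ×-dec T? (adj K u v)

HasNewColor : ∀ {n} → (Fin n → Fin n → ℕ) → Pred (Fin n × Fin n) Level.zero
HasNewColor f (u , v) = f u v ≢ 0

hasNewColor? : ∀ {n} (f : Fin n → Fin n → ℕ) → Decidable (HasNewColor f)
hasNewColor? f (u , v) = ¬? (f u v ≟ 0)

module _ {n : ℕ} {G H : Graph n} (H⊆G : SpanningSubgraph H G) where

  liftWalk : ∀ {u v} → Walk H u v → Walk G u v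
  liftWalk stop = stop
  liftWalk (step {u} {w} uw p) = step (H⊆G u w uw) (liftWalk p)

  vertices-liftWalk : ∀ {u v} (p : Walk H u v) → vertices (liftWalk p) ≡ vertices p
  vertices-liftWalk stop = refl
  vertices-liftWalk (step _ p) = cong (_ ∷_) (vertices-liftWalk p)

  edgeColors-liftWalk : (c : Fin n → Fin n → ℕ) → ∀ {u v} (p : Walk H u v) →
    edgeColors c (liftWalk p) ≡ edgeColors c p
  edgeColors-liftWalk c stop = refl
  edgeColors-liftWalk c (step {u} {w} _ p) = cong (c u w ∷_) (edgeColors-liftWalk c p)

module _ {n : ℕ} (H : Graph n) where

  extendByZero : (Fin n → Fin n → ℕ) → Fin n → Fin n → ℕ
  extendByZero c u v = if adj H u v then c u v else 0

  extendByZero-edge : (c : Fin n → Fin n → ℕ) → ∀ {u v} →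
    adj H u v ≡ true → extendByZero c u v ≡ c u v
  extendByZero-edge c uv rewrite uv = refl

  extendByZero-nonzero : (c : Fin n → Fin n → ℕ) → ∀ {u v} →
    extendByZero c u v ≢ 0 → adj H u v ≡ true
  extendByZero-nonzero c {u} {v} new with adj H u v
  ... | true = refl
  ... | false = ⊥-elim (new refl)

  extendByZero-agrees : (c : Fin n → Fin n → ℕ) → ∀ {u v} →
    extendByZero c u v ≢ 0 → extendByZero c u v ≡ c u v
  extendByZero-agrees c new = extendByZero-edge c (extendByZero-nonzero c new)

  edgeColors-extendByZero : (c : Fin n → Fin n → ℕ) → ∀ {u v} (p : Walk H u v) →
    edgeColors (extendByZero c) p ≡ edgeColors c p
  edgeColors-extendByZero c stop = refl
  edgeColors-extendByZero c (step uw p) =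
    cong₂ _∷_ (extendByZero-edge c uw) (edgeColors-extendByZero c p)

module _ {n : ℕ} {G H : Graph n} (H⊆G : SpanningSubgraph H G) (c : EdgeColoring H) where

  private
    c⁺ : Fin n → Fin n → ℕ
    c⁺ = extendByZero H (col c)

  extendColoring : EdgeColoring G
  extendColoring = record { col = c⁺ ; colSym = symmetric }
    where
    symmetric : ∀ u v → c⁺ u v ≡ c⁺ v u
    symmetric u v rewrite Graph.sym H u v =
      cong (λ k → if adj H v u then k else 0) (colSym c u v)

  properlyConnected-extend : ProperlyConnected H c → ProperlyConnected G extendColoring
  properlyConnected-extend pc u v u≢v with pc u v u≢v
  ... | p , path , proper =
    liftWalk H⊆G p ,
    subst Unique (≡-sym (vertices-liftWalk H⊆G p)) path ,
    subst (Linked _≢_) (≡-sym colorsAgree) proper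
    where
    colorsAgree : edgeColors c⁺ (liftWalk H⊆G p) ≡ edgeColors (col c) p
    colorsAgree = trans (edgeColors-liftWalk H⊆G c⁺ p) (edgeColors-extendByZero H (col c) p)

  sameRecoloredEdges :
    (IsListedEdge G ∩ HasNewColor c⁺) ≐ (IsListedEdge H ∩ HasNewColor (col c))
  sameRecoloredEdges = toH , toG
    where
    toH : IsListedEdge G ∩ HasNewColor c⁺ ⊆ IsListedEdge H ∩ HasNewColor (col c)
    toH {u , v} ((u<v , _) , new) =
      (u<v , Equivalence.from T-≡ (extendByZero-nonzero H (col c) new)) ,
      (λ zero → new (trans (extendByZero-agrees H (col c) new) zero))
    toG : IsListedEdge H ∩ HasNewColor (col c) ⊆ IsListedEdge G ∩ HasNewColor c⁺
    toG {u , v} ((u<v , inH) , new) =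
      (u<v , Equivalence.from T-≡ (H⊆G u v uvH)) ,
      (λ zero → new (trans (≡-sym (extendByZero-edge H (col c) uvH)) zero))
      where
      uvH : adj H u v ≡ true
      uvH = Equivalence.to T-≡ inH

  recoloredEdges-extend : recoloredEdges G extendColoring ≡ recoloredEdges H c
  recoloredEdges-extend = begin
    filter (hasNewColor? c⁺) (filter (isListedEdge? G) pairs)
      ≡⟨ filter-filter (isListedEdge? G) (hasNewColor? c⁺) pairs ⟩
    filter (isListedEdge? G ∩? hasNewColor? c⁺) pairs
      ≡⟨ filter-≐ (isListedEdge? G ∩? hasNewColor? c⁺)
                  (isListedEdge? H ∩? hasNewColor? (col c)) sameRecoloredEdges pairs ⟩
    filter (isListedEdge? H ∩? hasNewColor? (col c)) pairs
      ≡⟨ ≡-sym (filter-filter (isListedEdge? H) (hasNewColor? (col c)) pairs) ⟩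
    filter (hasNewColor? (col c)) (filter (isListedEdge? H) pairs)  ∎
    where
    open ≡-Reasoning
    pairs : List (Fin n × Fin n)
    pairs = cartesianProduct (allFin n) (allFin n)

  newColors-extend :
    map (λ e → c⁺ (proj₁ e) (proj₂ e)) (recoloredEdges G extendColoring) ≡
    map (λ e → col c (proj₁ e) (proj₂ e)) (recoloredEdges H c)
  newColors-extend = begin
    map (λ e → c⁺ (proj₁ e) (proj₂ e)) (recoloredEdges G extendColoring)
      ≡⟨ map-cong-local (All.map agrees recoloredAreNew) ⟩
    map (λ e → col c (proj₁ e) (proj₂ e)) (recoloredEdges G extendColoring)
      ≡⟨ cong (map (λ e → col c (proj₁ e) (proj₂ e))) recoloredEdges-extend ⟩
    map (λ e → col c (proj₁ e) (proj₂ e)) (recoloredEdges H c)  ∎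
    where
    open ≡-Reasoning
    recoloredAreNew : All.All (HasNewColor c⁺) (recoloredEdges G extendColoring)
    recoloredAreNew = all-filter (hasNewColor? c⁺) (edges G)
    agrees : ∀ {e} → HasNewColor c⁺ e → c⁺ (proj₁ e) (proj₂ e) ≡ col c (proj₁ e) (proj₂ e)
    agrees {u , v} new = extendByZero-agrees H (col c) new

  cost-extend : numRecolored G extendColoring + numNewColors G extendColoring ≡
                numRecolored H c + numNewColors H c
  cost-extend = cong₂ _+_ (cong length recoloredEdges-extend)
                          (cong (λ cs → length (deduplicate _≟_ cs)) newColors-extend)

attainable-mono : ∀ {n} {G H : Graph n} → SpanningSubgraph H G →
  ∀ {k} → Attainable H k → Attainable G k
attainable-mono {G = G} H⊆G (c , pc , cost≡k) =
  extendColoring H⊆G c ,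
  properlyConnected-extend {G = G} H⊆G c pc ,
  trans (cost-extend {G = G} H⊆G c) cost≡k

-- pc_opt(G) ≤ pc_opt(H): an optimal coloring of H extends to G at the same cost.
proposition1 : ∀ {n : ℕ} (G H : Graph n) → Connected G → Connected H →
    SpanningSubgraph H G → ∀ kG kH → IsPcOpt G kG → IsPcOpt H kH → kG ≤ kH
proposition1 G H _ _ H⊆G kG kH (_ , minimalG) (attainedH , _) =
  minimalG kH (attainable-mono H⊆G attainedH)
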